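{- Let $r,M,N$ be positive integers. Then \[ \sum_{i=1}^{N}\frac{q^{3^i r}\,u_{3^{i+M}r-3^i r}}{w_{3^i r}\,w_{3^{i+M}r}}=\sum_{i=1}^{M}\frac{q^{3^i r}\,u_{3^{i+N}r-3^i r}}{w_{3^i r}\,w_{3^{i+N}r}}, \] and, for either choice of sign (the same on both sides), \[ \sum_{i=1}^{2N}\frac{(\pm1)^i q^{3^i r}\,u_{3^{i+2M}r-3^i r}}{w_{3^i r}\,w_{3^{i+2M}r}}=\sum_{i=1}^{2M}\frac{(\pm1)^i q^{3^i r}\,u_{3^{i+2N}r-3^i r}}{w_{3^i r}\,w_{3^{i+2N}r}}. \]
   Context: Let $a,b,p,q$ be complex numbers. The generalized Lucas sequence $w_n=w_n(a,b;p,q)$ is defined by $w_0=a$, $w_1=b$, $w_n=pw_{n-1}-qw_{n-2}$, and the Lucas sequence of the first kind is $u_n=u_n(p,q)=w_n(0,1;p,q)$. Let $\alpha,\beta$ be the roots of $x^2-px+q=0$, labeled so that $|\alpha|>|\beta|$, with discriminant $D=p^2-4q\neq 0$; thus $\alpha+\beta=p$, $\alpha\beta=q$, $\alpha-\beta=\sqrt D$. With $A=b-a\beta$, $B=b-a\alpha$, one has $w_n=(A\alpha^n-B\beta^n)/(\alpha-\beta)$ and $u_n=(\alpha^n-\beta^n)/(\alpha-\beta)$. As implicit in the statement, all denominators appearing are assumed nonzero. -}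

module Defs where

open import Level using (Level; suc; _⊔_)
open import Data.Nat as ℕ using (ℕ; zero; _∸_)
open import Data.Bool using (Bool; true; false)
open import Relation.Nullary using (¬_)
open import Algebra.Bundles using (CommutativeRing)

-- A field: a commutative ring with 0 ≠ 1 and a (total) inverse operation
-- which is a genuine inverse on nonzero elements (its value at 0 is irrelevant).
record Field (c ℓ : Level) : Set (suc (c ⊔ ℓ)) where
  field
    commutativeRing : CommutativeRing c ℓ
  open CommutativeRing commutativeRing public
  field
    _⁻¹      : Carrier → Carrier
    ⁻¹-cong  : ∀ {x y} → x ≈ y → x ⁻¹ ≈ y ⁻¹
    0≉1      : ¬ (0# ≈ 1#)
    inverseʳ : ∀ x → ¬ (x ≈ 0#) → x * (x ⁻¹) ≈ 1#

module FieldDefs {c ℓ : Level} (F : Field c ℓ) where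
  open Field F public

  infixl 7 _/_
  _/_ : Carrier → Carrier → Carrier
  x / y = x * (y ⁻¹)

  pow : Carrier → ℕ → Carrier
  pow x zero = 1#
  pow x (ℕ.suc n) = pow x n * x

  w : (a b p q : Carrier) → ℕ → Carrier
  w a b p q zero = a
  w a b p q (ℕ.suc zero) = b
  w a b p q (ℕ.suc (ℕ.suc n)) = p * w a b p q (ℕ.suc n) - q * w a b p q n

  u : (p q : Carrier) → ℕ → Carrier
  u p q = w 0# 1# p q

  Σ₁ : ℕ → (ℕ → Carrier) → Carrier
  Σ₁ zero f = 0#
  Σ₁ (ℕ.suc n) f = Σ₁ n f + f (ℕ.suc n)

  sgnPow : Bool → ℕ → Carrier
  sgnPow true i = 1#
  sgnPow false i = pow (- 1#) i

  term : (a b p q : Carrier) (s : Bool) (r K i : ℕ) → Carrier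
  term a b p q s r K i =
    (sgnPow s i * pow q (3 ℕ.^ i ℕ.* r) * u p q (3 ℕ.^ (i ℕ.+ K) ℕ.* r ∸ 3 ℕ.^ i ℕ.* r))
      / (w a b p q (3 ℕ.^ i ℕ.* r) * w a b p q (3 ℕ.^ (i ℕ.+ K) ℕ.* r))

module Submission where

-- For a second solution v = w(c,d) of the same recurrence, the Casoratian satisfies
-- w_m v_n − v_m w_n = q^m (a d − b c) u_{n−m}.  Hence (a d − b c) times the summand
-- with indices m = 3^i r ≤ n = 3^{i+K} r is the difference g(i+K) − g(i) of
-- g(i) = (±1)^i v_{3^i r} / w_{3^i r} (the sign needs period K, hence the even bounds),
-- and both sides telescope to Σ_{i≤N+K} g − Σ_{i≤N} g − Σ_{i≤K} g.  This proves the
-- identity multiplied by a d − b c for all c, d; so the difference of the two sides is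
-- annihilated by a and b, hence by every w_k, and w_{3r} ≠ 0 forces it to vanish.

open import Defs
open import Level using (Level)
open import Algebra.Bundles using (CommutativeRing)
open import Algebra.Solver.Ring.AlmostCommutativeRing
  using (_-Raw-AlmostCommutative⟶_; fromCommutativeRing)
open import Data.Bool using (Bool; true; false)
open import Data.Integer as ℤ using (ℤ; +_; -[1+_]; _⊖_; _◃_; sign; ∣_∣)
import Data.Integer.Properties as ℤP
open import Data.Maybe using (Maybe; just; nothing)
open import Data.Nat as ℕ using (ℕ; zero; suc; NonZero; _≤_; _∸_)
import Data.Nat.Properties as ℕP
open import Data.Product using (_×_; _,_; proj₁; proj₂)
open import Data.Sign as Sign using (Sign)
open import Relation.Nullary using (¬_; yes; no)
import Relation.Binary.PropositionalEquality as ≡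

-- Integer coefficients let the normaliser see that x − x = 0; over the ring's own
-- carrier (Tactic.RingSolver) zero coefficients cannot be detected.
module IntegerCoefficientSolver {c ℓ} (R : CommutativeRing c ℓ) where
  open CommutativeRing R
  open import Algebra.Properties.Ring ring using (-0#≈0#; -1*x≈-x; -‿+-comm; -‿involutive)
  open import Algebra.Properties.CommutativeSemigroup +-commutativeSemigroup
    using (interchange; x∙yz≈y∙xz)
  open import Algebra.Properties.CommutativeSemigroup *-commutativeSemigroup
    using () renaming (interchange to *-interchange)
  open import Algebra.Properties.Semiring.Mult.TCOptimised semiring using (1+×; ×-homo-+; ×1-homo-*)
    renaming (_×_ to _·_)
  open import Relation.Binary.Reasoning.Setoid setoid

  fromℤ : ℤ → Carrier
  fromℤ (+ n)    = n · 1#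
  fromℤ -[1+ n ] = - (suc n · 1#)

  [1+x]-[1+y]≈x-y : ∀ x y → (1# + x) - (1# + y) ≈ x - y
  [1+x]-[1+y]≈x-y x y = begin
    (1# + x) - (1# + y)       ≈⟨ +-congˡ (-‿+-comm 1# y) ⟨
    (1# + x) + (- 1# + - y)   ≈⟨ interchange 1# x (- 1#) (- y) ⟩
    (1# - 1#) + (x - y)       ≈⟨ +-congʳ (-‿inverseʳ 1#) ⟩
    0# + (x - y)              ≈⟨ +-identityˡ _ ⟩
    x - y                     ∎

  fromℤ-⊖ : ∀ m n → fromℤ (m ⊖ n) ≈ m · 1# - n · 1#
  fromℤ-⊖ zero    zero    = sym (-‿inverseʳ 0#)
  fromℤ-⊖ (suc m) zero    = sym (trans (+-congˡ -0#≈0#) (+-identityʳ _))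
  fromℤ-⊖ zero    (suc n) = sym (+-identityˡ _)
  fromℤ-⊖ (suc m) (suc n) = begin
    fromℤ (suc m ⊖ suc n)              ≡⟨ ≡.cong fromℤ (ℤP.[1+m]⊖[1+n]≡m⊖n m n) ⟩
    fromℤ (m ⊖ n)                      ≈⟨ fromℤ-⊖ m n ⟩
    m · 1# - n · 1#                    ≈⟨ [1+x]-[1+y]≈x-y _ _ ⟨
    (1# + m · 1#) - (1# + n · 1#)      ≈⟨ +-cong (1+× m 1#) (-‿cong (1+× n 1#)) ⟨
    suc m · 1# - suc n · 1#            ∎

  fromℤ-+ : ∀ i j → fromℤ (i ℤ.+ j) ≈ fromℤ i + fromℤ j
  fromℤ-+ (+ m)    (+ n)    = ×-homo-+ 1# m n
  fromℤ-+ (+ m)    -[1+ n ] = fromℤ-⊖ m (suc n)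
  fromℤ-+ -[1+ m ] (+ n)    = trans (fromℤ-⊖ n (suc m)) (+-comm _ _)
  fromℤ-+ -[1+ m ] -[1+ n ] = trans (-‿cong (begin
    suc (suc m ℕ.+ n) · 1#           ≈⟨ 1+× (suc m ℕ.+ n) 1# ⟩
    1# + (suc m ℕ.+ n) · 1#          ≈⟨ +-congˡ (×-homo-+ 1# (suc m) n) ⟩
    1# + (suc m · 1# + n · 1#)       ≈⟨ x∙yz≈y∙xz 1# _ _ ⟩
    suc m · 1# + (1# + n · 1#)       ≈⟨ +-congˡ (1+× n 1#) ⟨
    suc m · 1# + suc n · 1#          ∎)) (sym (-‿+-comm _ _))

  fromSign : Sign → Carrier
  fromSign Sign.+ = 1#
  fromSign Sign.- = - 1#

  fromSign-* : ∀ s t → fromSign (s Sign.* t) ≈ fromSign s * fromSign t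
  fromSign-* Sign.+ t       = sym (*-identityˡ _)
  fromSign-* Sign.- Sign.+ = sym (*-identityʳ _)
  fromSign-* Sign.- Sign.- = sym (trans (-1*x≈-x _) (-‿involutive 1#))

  fromℤ-◃ : ∀ s n → fromℤ (s ◃ n) ≈ fromSign s * (n · 1#)
  fromℤ-◃ s      zero    = sym (zeroʳ _)
  fromℤ-◃ Sign.+ (suc n) = sym (*-identityˡ _)
  fromℤ-◃ Sign.- (suc n) = sym (-1*x≈-x _)

  fromℤ-sign-∣∣ : ∀ i → fromℤ i ≈ fromSign (sign i) * (∣ i ∣ · 1#)
  fromℤ-sign-∣∣ (+ n)    = sym (*-identityˡ _)
  fromℤ-sign-∣∣ -[1+ n ] = sym (-1*x≈-x _)

  fromℤ-* : ∀ i j → fromℤ (i ℤ.* j) ≈ fromℤ i * fromℤ j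
  fromℤ-* i j = begin
    fromℤ (sign i Sign.* sign j ◃ ∣ i ∣ ℕ.* ∣ j ∣)
      ≈⟨ fromℤ-◃ (sign i Sign.* sign j) (∣ i ∣ ℕ.* ∣ j ∣) ⟩
    fromSign (sign i Sign.* sign j) * ((∣ i ∣ ℕ.* ∣ j ∣) · 1#)
      ≈⟨ *-cong (fromSign-* (sign i) (sign j)) (×1-homo-* ∣ i ∣ ∣ j ∣) ⟩
    (fromSign (sign i) * fromSign (sign j)) * (∣ i ∣ · 1# * ∣ j ∣ · 1#)
      ≈⟨ *-interchange _ _ _ _ ⟩
    (fromSign (sign i) * ∣ i ∣ · 1#) * (fromSign (sign j) * ∣ j ∣ · 1#)
      ≈⟨ *-cong (fromℤ-sign-∣∣ i) (fromℤ-sign-∣∣ j) ⟨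
    fromℤ i * fromℤ j ∎

  fromℤ-neg : ∀ i → fromℤ (ℤ.- i) ≈ - fromℤ i
  fromℤ-neg (+ zero)  = sym -0#≈0#
  fromℤ-neg (+ suc n) = refl
  fromℤ-neg -[1+ n ]  = sym (-‿involutive _)

  fromℤ-morphism : ℤ.+-*-rawRing -Raw-AlmostCommutative⟶ fromCommutativeRing R
  fromℤ-morphism = record
    { ⟦_⟧ = fromℤ ; +-homo = fromℤ-+ ; *-homo = fromℤ-* ; -‿homo = fromℤ-neg
    ; 0-homo = refl ; 1-homo = refl }

  fromℤ-≟ : ∀ i j → Maybe (fromℤ i ≈ fromℤ j)
  fromℤ-≟ i j with i ℤ.≟ j
  ... | yes ≡.refl = just refl
  ... | no _       = nothing

  open import Algebra.Solver.Ring ℤ.+-*-rawRing (fromCommutativeRing R) fromℤ-morphism fromℤ-≟ public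

module LucasSums {c ℓ} (F : Field c ℓ) where
  open FieldDefs F
  open IntegerCoefficientSolver commutativeRing using (solve; _:=_; _:+_; _:*_; _:-_; :-_; con)
  open import Algebra.Properties.Group +-group using (x∙y⁻¹≈ε⇒x≈y)
  open import Relation.Binary.Reasoning.Setoid setoid

  x≉0∧x*y≈0⇒y≈0 : ∀ {x y} → ¬ (x ≈ 0#) → x * y ≈ 0# → y ≈ 0#
  x≉0∧x*y≈0⇒y≈0 {x} {y} x≉0 xy≈0 = begin
    y                   ≈⟨ *-identityˡ y ⟨
    1# * y              ≈⟨ *-congʳ (inverseʳ x x≉0) ⟨
    (x * x ⁻¹) * y      ≈⟨ solve 3 (λ x x⁻¹ y → (x :* x⁻¹) :* y := x⁻¹ :* (x :* y)) refl x (x ⁻¹) y ⟩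
    x ⁻¹ * (x * y)      ≈⟨ *-congˡ xy≈0 ⟩
    x ⁻¹ * 0#           ≈⟨ zeroʳ _ ⟩
    0#                  ∎

  *-nonzero : ∀ {x y} → ¬ (x ≈ 0#) → ¬ (y ≈ 0#) → ¬ (x * y ≈ 0#)
  *-nonzero x≉0 y≉0 xy≈0 = y≉0 (x≉0∧x*y≈0⇒y≈0 x≉0 xy≈0)

  inverse-unique : ∀ {x y} → ¬ (x ≈ 0#) → x * y ≈ 1# → y ≈ x ⁻¹
  inverse-unique {x} {y} x≉0 xy≈1 = begin
    y                   ≈⟨ *-identityʳ y ⟨
    y * 1#              ≈⟨ *-congˡ (inverseʳ x x≉0) ⟨
    y * (x * x ⁻¹)      ≈⟨ solve 3 (λ x x⁻¹ y → y :* (x :* x⁻¹) := (x :* y) :* x⁻¹) refl x (x ⁻¹) y ⟩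
    (x * y) * x ⁻¹      ≈⟨ *-congʳ xy≈1 ⟩
    1# * x ⁻¹           ≈⟨ *-identityˡ _ ⟩
    x ⁻¹                ∎

  ⁻¹-distrib-* : ∀ {x y} → ¬ (x ≈ 0#) → ¬ (y ≈ 0#) → (x * y) ⁻¹ ≈ x ⁻¹ * y ⁻¹
  ⁻¹-distrib-* {x} {y} x≉0 y≉0 = sym (inverse-unique (*-nonzero x≉0 y≉0) (begin
    (x * y) * (x ⁻¹ * y ⁻¹)     ≈⟨ solve 4 (λ x y x⁻¹ y⁻¹ → (x :* y) :* (x⁻¹ :* y⁻¹) := (x :* x⁻¹) :* (y :* y⁻¹)) refl x y (x ⁻¹) (y ⁻¹) ⟩
    (x * x ⁻¹) * (y * y ⁻¹)     ≈⟨ *-cong (inverseʳ x x≉0) (inverseʳ y y≉0) ⟩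
    1# * 1#                     ≈⟨ *-identityˡ 1# ⟩
    1#                          ∎))

  Σ₁-cong : ∀ n {f g : ℕ → Carrier} → (∀ i → 1 ≤ i → i ≤ n → f i ≈ g i) → Σ₁ n f ≈ Σ₁ n g
  Σ₁-cong zero    f≈g = refl
  Σ₁-cong (suc n) f≈g = +-cong (Σ₁-cong n (λ i 1≤i i≤n → f≈g i 1≤i (ℕP.m≤n⇒m≤1+n i≤n)))
                               (f≈g (suc n) (ℕ.s≤s ℕ.z≤n) ℕP.≤-refl)

  *-distribˡ-Σ₁ : ∀ n x (f : ℕ → Carrier) → x * Σ₁ n f ≈ Σ₁ n (λ i → x * f i)
  *-distribˡ-Σ₁ zero    x f = zeroʳ x
  *-distribˡ-Σ₁ (suc n) x f = trans (distribˡ x _ _) (+-congʳ (*-distribˡ-Σ₁ n x f))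

  Σ₁-distrib-- : ∀ n (f g : ℕ → Carrier) → Σ₁ n (λ i → f i - g i) ≈ Σ₁ n f - Σ₁ n g
  Σ₁-distrib-- zero    f g = solve 0 (con (+ 0) := con (+ 0) :- con (+ 0)) refl
  Σ₁-distrib-- (suc n) f g = begin
    Σ₁ n (λ i → f i - g i) + (f (suc n) - g (suc n)) ≈⟨ +-congʳ (Σ₁-distrib-- n f g) ⟩
    (Σ₁ n f - Σ₁ n g) + (f (suc n) - g (suc n))      ≈⟨ solve 4 (λ A B x y → (A :- B) :+ (x :- y) := (A :+ x) :- (B :+ y)) refl _ _ _ _ ⟩
    (Σ₁ n f + f (suc n)) - (Σ₁ n g + g (suc n))      ∎

  Σ₁-shift : ∀ n K (g : ℕ → Carrier) → Σ₁ n (λ i → g (i ℕ.+ K)) + Σ₁ K g ≈ Σ₁ (n ℕ.+ K) g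
  Σ₁-shift zero    K g = +-identityˡ _
  Σ₁-shift (suc n) K g = begin
    (Σ₁ n (λ i → g (i ℕ.+ K)) + g (suc n ℕ.+ K)) + Σ₁ K g ≈⟨ solve 3 (λ A x B → (A :+ x) :+ B := (A :+ B) :+ x) refl _ _ _ ⟩
    (Σ₁ n (λ i → g (i ℕ.+ K)) + Σ₁ K g) + g (suc n ℕ.+ K) ≈⟨ +-congʳ (Σ₁-shift n K g) ⟩
    Σ₁ (n ℕ.+ K) g + g (suc n ℕ.+ K)                     ∎

  Σ₁-differences-swap : ∀ N K (g : ℕ → Carrier) →
    Σ₁ N (λ i → g (i ℕ.+ K) - g i) ≈ Σ₁ K (λ i → g (i ℕ.+ N) - g i)
  Σ₁-differences-swap N K g = begin
    Σ₁ N (λ i → g (i ℕ.+ K) - g i)                         ≈⟨ Σ₁-distrib-- N _ g ⟩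
    Σ₁ N (λ i → g (i ℕ.+ K)) - Σ₁ N g                      ≈⟨ solve 3 (λ A B C → A :- B := (A :+ C) :- C :- B) refl _ _ (Σ₁ K g) ⟩
    (Σ₁ N (λ i → g (i ℕ.+ K)) + Σ₁ K g) - Σ₁ K g - Σ₁ N g  ≈⟨ +-congʳ (+-congʳ (Σ₁-shift N K g)) ⟩
    Σ₁ (N ℕ.+ K) g - Σ₁ K g - Σ₁ N g                       ≡⟨ ≡.cong (λ t → Σ₁ t g - Σ₁ K g - Σ₁ N g) (ℕP.+-comm N K) ⟩
    Σ₁ (K ℕ.+ N) g - Σ₁ K g - Σ₁ N g                       ≈⟨ +-congʳ (+-congʳ (Σ₁-shift K N g)) ⟨
    (Σ₁ K (λ i → g (i ℕ.+ N)) + Σ₁ N g) - Σ₁ K g - Σ₁ N g  ≈⟨ solve 3 (λ A B C → (A :+ B) :- C :- B := A :- C) refl _ _ _ ⟩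
    Σ₁ K (λ i → g (i ℕ.+ N)) - Σ₁ K g                      ≈⟨ Σ₁-distrib-- K _ g ⟨
    Σ₁ K (λ i → g (i ℕ.+ N) - g i)                         ∎

  IsLucas : Carrier → Carrier → (ℕ → Carrier) → Set ℓ
  IsLucas p q X = ∀ k → X (suc (suc k)) ≈ p * X (suc k) - q * X k

  module _ {p q : Carrier} where

    w-isLucas : ∀ a b → IsLucas p q (w a b p q)
    w-isLucas a b k = refl

    0-isLucas : IsLucas p q (λ _ → 0#)
    0-isLucas k = solve 2 (λ p q → con (+ 0) := p :* con (+ 0) :- q :* con (+ 0)) refl p q

    isLucas-*ˡ : ∀ {X} t → IsLucas p q X → IsLucas p q (λ k → t * X k)
    isLucas-*ˡ {X} t X-rec k = begin
      t * X (suc (suc k))                 ≈⟨ *-congˡ (X-rec k) ⟩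
      t * (p * X (suc k) - q * X k)       ≈⟨ solve 5 (λ t p q x₁ x₀ → t :* (p :* x₁ :- q :* x₀) := p :* (t :* x₁) :- q :* (t :* x₀)) refl t p q _ _ ⟩
      p * (t * X (suc k)) - q * (t * X k) ∎

    isLucas-- : ∀ {X Y} → IsLucas p q X → IsLucas p q Y → IsLucas p q (λ k → X k - Y k)
    isLucas-- {X} {Y} X-rec Y-rec k = begin
      X (suc (suc k)) - Y (suc (suc k))                               ≈⟨ +-cong (X-rec k) (-‿cong (Y-rec k)) ⟩
      (p * X (suc k) - q * X k) - (p * Y (suc k) - q * Y k)           ≈⟨ solve 6 (λ p q x₁ x₀ y₁ y₀ → (p :* x₁ :- q :* x₀) :- (p :* y₁ :- q :* y₀) := p :* (x₁ :- y₁) :- q :* (x₀ :- y₀)) refl p q _ _ _ _ ⟩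
      p * (X (suc k) - Y (suc k)) - q * (X k - Y k)                   ∎

    isLucas-shift : ∀ {X} m → IsLucas p q X → IsLucas p q (λ k → X (k ℕ.+ m))
    isLucas-shift m X-rec k = X-rec (k ℕ.+ m)

    isLucas-unique : ∀ {X Y} → IsLucas p q X → IsLucas p q Y → X 0 ≈ Y 0 → X 1 ≈ Y 1 → ∀ k → X k ≈ Y k
    isLucas-unique {X} {Y} X-rec Y-rec X₀≈Y₀ X₁≈Y₁ k = proj₁ (agree k)
      where
      agree : ∀ k → X k ≈ Y k × X (suc k) ≈ Y (suc k)
      agree zero    = X₀≈Y₀ , X₁≈Y₁
      agree (suc k) = proj₂ (agree k) , (begin
        X (suc (suc k))               ≈⟨ X-rec k ⟩
        p * X (suc k) - q * X k       ≈⟨ +-cong (*-congˡ (proj₂ (agree k))) (-‿cong (*-congˡ (proj₁ (agree k)))) ⟩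
        p * Y (suc k) - q * Y k       ≈⟨ Y-rec k ⟨
        Y (suc (suc k))               ∎)

  w-annihilated : ∀ {a b p q z} → z * a ≈ 0# → z * b ≈ 0# → ∀ k → z * w a b p q k ≈ 0#
  w-annihilated {a} {b} za≈0 zb≈0 =
    isLucas-unique (isLucas-*ˡ _ (w-isLucas a b)) 0-isLucas za≈0 zb≈0

  -- a d − b c is the Casoratian of w(a,b) and w(c,d) at 0; (c,d) = (0,1) and (1,0) turn it into a and − b.
  cancel-Casoratian : ∀ a b p q {x y} → (∀ c d → (a * d - b * c) * x ≈ (a * d - b * c) * y) →
                      ∀ j → ¬ (w a b p q j ≈ 0#) → x ≈ y
  cancel-Casoratian a b p q {x} {y} C*x≈C*y j wⱼ≉0 =
    x∙y⁻¹≈ε⇒x≈y x y (x≉0∧x*y≈0⇒y≈0 wⱼ≉0 (trans (*-comm _ _) (w-annihilated za≈0 zb≈0 j)))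
    where
    C*[x-y]≈0 : ∀ c d → (a * d - b * c) * (x - y) ≈ 0#
    C*[x-y]≈0 c d = begin
      C * (x - y)      ≈⟨ solve 3 (λ C x y → C :* (x :- y) := C :* x :- C :* y) refl C x y ⟩
      C * x - C * y    ≈⟨ +-congʳ (C*x≈C*y c d) ⟩
      C * y - C * y    ≈⟨ -‿inverseʳ _ ⟩
      0#               ∎
      where
      C : Carrier
      C = a * d - b * c
    za≈0 : (x - y) * a ≈ 0#
    za≈0 = trans (solve 3 (λ a b z → z :* a := (a :* con (+ 1) :- b :* con (+ 0)) :* z) refl a b (x - y)) (C*[x-y]≈0 0# 1#)
    zb≈0 : (x - y) * b ≈ 0#
    zb≈0 = begin
      (x - y) * b                              ≈⟨ solve 3 (λ a b z → z :* b := :- ((a :* con (+ 0) :- b :* con (+ 1)) :* z)) refl a b (x - y) ⟩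
      - ((a * 0# - b * 1#) * (x - y))          ≈⟨ -‿cong (C*[x-y]≈0 1# 0#) ⟩
      - 0#                                     ≈⟨ solve 0 (:- con (+ 0) := con (+ 0)) refl ⟩
      0#                                       ∎

  module _ (a b c d p q : Carrier) where
    private
      W V : ℕ → Carrier
      W = w a b p q
      V = w c d p q

    casoratian-suc : ∀ m → W m * V (suc m) - V m * W (suc m) ≈ pow q m * (a * d - b * c)
    casoratian-suc zero    = solve 4 (λ a b c d → a :* d :- c :* b := con (+ 1) :* (a :* d :- b :* c)) refl a b c d
    casoratian-suc (suc m) = begin
      W (suc m) * V (suc (suc m)) - V (suc m) * W (suc (suc m))
        ≈⟨ solve 6 (λ p q W₁ V₁ W₀ V₀ → W₁ :* (p :* V₁ :- q :* V₀) :- V₁ :* (p :* W₁ :- q :* W₀) := q :* (W₀ :* V₁ :- V₀ :* W₁)) refl p q _ _ _ _ ⟩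
      q * (W m * V (suc m) - V m * W (suc m))   ≈⟨ *-congˡ (casoratian-suc m) ⟩
      q * (pow q m * (a * d - b * c))           ≈⟨ solve 3 (λ q Q C → q :* (Q :* C) := Q :* q :* C) refl q _ _ ⟩
      pow q m * q * (a * d - b * c)             ∎

    casoratian : ∀ m k → W m * V (k ℕ.+ m) - V m * W (k ℕ.+ m) ≈ pow q m * (a * d - b * c) * u p q k
    casoratian m = isLucas-unique
      (isLucas-- (isLucas-*ˡ (W m) (isLucas-shift m (w-isLucas c d)))
                 (isLucas-*ˡ (V m) (isLucas-shift m (w-isLucas a b))))
      (isLucas-*ˡ (pow q m * (a * d - b * c)) (w-isLucas 0# 1#))
      (solve 3 (λ x y t → x :* y :- y :* x := t :* con (+ 0)) refl (W m) (V m) _)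
      (trans (casoratian-suc m) (solve 1 (λ t → t := t :* con (+ 1)) refl _))

    casoratian-≤ : ∀ {m n} → m ≤ n → W m * V n - V m * W n ≈ pow q m * (a * d - b * c) * u p q (n ∸ m)
    casoratian-≤ {m} {n} m≤n =
      ≡.subst (λ t → W m * V t - V m * W t ≈ pow q m * (a * d - b * c) * u p q (n ∸ m))
              (ℕP.m∸n+n≡m m≤n) (casoratian m (n ∸ m))

    ratio-difference : ∀ {m n} → m ≤ n → ¬ (W m ≈ 0#) → ¬ (W n ≈ 0#) → ∀ s →
      (a * d - b * c) * ((s * pow q m * u p q (n ∸ m)) / (W m * W n)) ≈ s * (V n / W n) - s * (V m / W m)
    ratio-difference {m} {n} m≤n Wₘ≉0 Wₙ≉0 s = begin
      C * (s * Q * U * (W m * W n) ⁻¹)                  ≈⟨ *-congˡ (*-congˡ (⁻¹-distrib-* Wₘ≉0 Wₙ≉0)) ⟩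
      C * (s * Q * U * (W m ⁻¹ * W n ⁻¹))              ≈⟨ solve 6 (λ C s Q U Wₘ⁻¹ Wₙ⁻¹ → C :* (s :* Q :* U :* (Wₘ⁻¹ :* Wₙ⁻¹)) := s :* (Q :* C :* U) :* Wₘ⁻¹ :* Wₙ⁻¹) refl C s Q U _ _ ⟩
      s * (Q * C * U) * W m ⁻¹ * W n ⁻¹                ≈⟨ *-congʳ (*-congʳ (*-congˡ (casoratian-≤ m≤n))) ⟨
      s * (W m * V n - V m * W n) * W m ⁻¹ * W n ⁻¹    ≈⟨ solve 7 (λ s Wₘ Vₙ Vₘ Wₙ Wₘ⁻¹ Wₙ⁻¹ → s :* (Wₘ :* Vₙ :- Vₘ :* Wₙ) :* Wₘ⁻¹ :* Wₙ⁻¹ := s :* (Vₙ :* Wₙ⁻¹ :* (Wₘ :* Wₘ⁻¹) :- Vₘ :* Wₘ⁻¹ :* (Wₙ :* Wₙ⁻¹))) refl s _ _ _ _ _ _ ⟩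
      s * (V n / W n * (W m * W m ⁻¹) - V m / W m * (W n * W n ⁻¹))
                                                         ≈⟨ *-congˡ (+-cong (*-congˡ (inverseʳ _ Wₘ≉0)) (-‿cong (*-congˡ (inverseʳ _ Wₙ≉0)))) ⟩
      s * (V n / W n * 1# - V m / W m * 1#)             ≈⟨ solve 3 (λ s x y → s :* (x :* con (+ 1) :- y :* con (+ 1)) := s :* x :- s :* y) refl s _ _ ⟩
      s * (V n / W n) - s * (V m / W m)                 ∎
      where
      C Q U : Carrier
      C = a * d - b * c
      Q = pow q m
      U = u p q (n ∸ m)

  lucasTerm : (a b p q : Carrier) (e : ℕ → ℕ) (ε : ℕ → Carrier) (K i : ℕ) → Carrier
  lucasTerm a b p q e ε K i =
    (ε i * pow q (e i) * u p q (e (i ℕ.+ K) ∸ e i)) / (w a b p q (e i) * w a b p q (e (i ℕ.+ K)))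

  Periodic : (ℕ → Carrier) → ℕ → Set ℓ
  Periodic ε K = ∀ i → ε (i ℕ.+ K) ≈ ε i

  module _ (a b p q : Carrier) {e : ℕ → ℕ} {ε : ℕ → Carrier}
           (e-mono : ∀ {i j} → i ≤ j → e i ≤ e j) where

    NonVanishingUpTo : ℕ → Set ℓ
    NonVanishingUpTo n = ∀ i → 1 ≤ i → i ≤ n → ¬ (w a b p q (e i) ≈ 0#)

    lucasTerm-telescopes : ∀ c d A B → Periodic ε B → NonVanishingUpTo (A ℕ.+ B) → ∀ i → 1 ≤ i → i ≤ A →
      let g = λ i → ε i * (w c d p q (e i) / w a b p q (e i)) in
      (a * d - b * c) * lucasTerm a b p q e ε B i ≈ g (i ℕ.+ B) - g i
    lucasTerm-telescopes c d A B ε-per nz i 1≤i i≤A =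
      trans (ratio-difference a b c d p q (e-mono (ℕP.m≤m+n i B))
               (nz i 1≤i (ℕP.≤-trans i≤A (ℕP.m≤m+n A B)))
               (nz (i ℕ.+ B) (ℕP.≤-trans 1≤i (ℕP.m≤m+n i B)) (ℕP.+-monoˡ-≤ B i≤A))
               (ε i))
            (+-congʳ (*-congʳ (sym (ε-per i))))

    Σ₁-lucasTerm-swap : ∀ N K → Periodic ε K → Periodic ε N → 1 ≤ N ℕ.+ K → NonVanishingUpTo (N ℕ.+ K) →
      Σ₁ N (lucasTerm a b p q e ε K) ≈ Σ₁ K (lucasTerm a b p q e ε N)
    Σ₁-lucasTerm-swap N K ε-perK ε-perN 1≤N+K nz =
      cancel-Casoratian a b p q scaled (e 1) (nz 1 ℕP.≤-refl 1≤N+K)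
      where
      nz′ : NonVanishingUpTo (K ℕ.+ N)
      nz′ i 1≤i i≤K+N = nz i 1≤i (≡.subst (i ≤_) (ℕP.+-comm K N) i≤K+N)
      scaled : ∀ c d → (a * d - b * c) * Σ₁ N (lucasTerm a b p q e ε K) ≈ (a * d - b * c) * Σ₁ K (lucasTerm a b p q e ε N)
      scaled c d = begin
        C * Σ₁ N (lucasTerm a b p q e ε K)          ≈⟨ *-distribˡ-Σ₁ N C _ ⟩
        Σ₁ N (λ i → C * lucasTerm a b p q e ε K i)  ≈⟨ Σ₁-cong N (lucasTerm-telescopes c d N K ε-perK nz) ⟩
        Σ₁ N (λ i → g (i ℕ.+ K) - g i)              ≈⟨ Σ₁-differences-swap N K g ⟩
        Σ₁ K (λ i → g (i ℕ.+ N) - g i)              ≈⟨ Σ₁-cong K (lucasTerm-telescopes c d K N ε-perN nz′) ⟨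
        Σ₁ K (λ i → C * lucasTerm a b p q e ε N i)  ≈⟨ *-distribˡ-Σ₁ K C _ ⟨
        C * Σ₁ K (lucasTerm a b p q e ε N)          ∎
        where
        C : Carrier
        C = a * d - b * c
        g : ℕ → Carrier
        g i = ε i * (w c d p q (e i) / w a b p q (e i))

  periodic-multiple : ∀ {ε K} → Periodic ε K → ∀ M → Periodic ε (K ℕ.* M)
  periodic-multiple {ε} {K} ε-per zero    i =
    reflexive (≡.cong ε (≡.trans (≡.cong (i ℕ.+_) (ℕP.*-zeroʳ K)) (ℕP.+-identityʳ i)))
  periodic-multiple {ε} {K} ε-per (suc M) i = begin
    ε (i ℕ.+ K ℕ.* suc M)       ≡⟨ ≡.cong ε (≡.trans (≡.cong (i ℕ.+_) (ℕP.*-suc K M)) (≡.sym (ℕP.+-assoc i K (K ℕ.* M)))) ⟩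
    ε (i ℕ.+ K ℕ.+ K ℕ.* M)     ≈⟨ periodic-multiple ε-per M (i ℕ.+ K) ⟩
    ε (i ℕ.+ K)                 ≈⟨ ε-per i ⟩
    ε i                         ∎

  sgnPow-periodic : ∀ s → Periodic (sgnPow s) 2
  sgnPow-periodic true  i = refl
  sgnPow-periodic false i = begin
    pow (- 1#) (i ℕ.+ 2)            ≡⟨ ≡.cong (pow (- 1#)) (ℕP.+-comm i 2) ⟩
    pow (- 1#) i * - 1# * - 1#      ≈⟨ solve 1 (λ x → x :* con -[1+ 0 ] :* con -[1+ 0 ] := x) refl _ ⟩
    pow (- 1#) i                    ∎


corollary18 : ∀ {c ℓ : Level} (F : Field c ℓ) → let open FieldDefs F in
    ∀ (a b p q : Carrier) → ¬ (p * p - (1# + 1# + 1# + 1#) * q ≈ 0#) →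
    ∀ (r M N : ℕ) → .{{NonZero r}} → .{{NonZero M}} → .{{NonZero N}} →
      ((∀ i → 1 ℕ.≤ i → i ℕ.≤ N ℕ.+ M → ¬ (w a b p q (3 ℕ.^ i ℕ.* r) ≈ 0#)) →
        Σ₁ N (term a b p q true r M) ≈ Σ₁ M (term a b p q true r N))
      × ((∀ i → 1 ℕ.≤ i → i ℕ.≤ 2 ℕ.* N ℕ.+ 2 ℕ.* M → ¬ (w a b p q (3 ℕ.^ i ℕ.* r) ≈ 0#)) →
        ∀ (s : Bool) → Σ₁ (2 ℕ.* N) (term a b p q s r (2 ℕ.* M)) ≈ Σ₁ (2 ℕ.* M) (term a b p q s r (2 ℕ.* N)))
corollary18 F a b p q _ r M N =
  (λ nz → Σ₁-lucasTerm-swap a b p q {ε = sgnPow true} 3^i*r-mono N M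
            (λ _ → refl) (λ _ → refl) (ℕP.m≤n⇒m≤o+n N 1≤M) nz) ,
  (λ nz s → Σ₁-lucasTerm-swap a b p q {ε = sgnPow s} 3^i*r-mono (2 ℕ.* N) (2 ℕ.* M)
              (periodic-multiple (sgnPow-periodic s) M) (periodic-multiple (sgnPow-periodic s) N)
              (ℕP.m≤n⇒m≤o+n (2 ℕ.* N) (ℕP.≤-trans 1≤M (ℕP.m≤m+n M _))) nz)
  where
  open FieldDefs F
  open LucasSums F
  3^i*r-mono : ∀ {i j} → i ≤ j → 3 ℕ.^ i ℕ.* r ≤ 3 ℕ.^ j ℕ.* r
  3^i*r-mono i≤j = ℕP.*-monoˡ-≤ r (ℕP.^-monoʳ-≤ 3 i≤j)
  1≤M : 1 ≤ M
  1≤M = ℕ.>-nonZero⁻¹ M
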